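{- Let $B$ be a type, $x,y:B^\nu$ and $b:B$, and assume $x\sqsubseteq y$. If $x\downarrow b$ then $\mathsf{fstconv}\,x\,y\downarrow b$.
   Context: Work in an intensional constructive dependent type theory with inductive and coinductive types. For a type $B$, $B^\nu$ is the coinductive type with constructors $\mathsf{return}:B\to B^\nu$ and $\mathsf{step}:B^\nu\to B^\nu$. Convergence $x\downarrow b$ is inductive: $\mathsf{return}\,b\downarrow b$; $x\downarrow b\Rightarrow\mathsf{step}\,x\downarrow b$. The convergence order $x\sqsubseteq y$ is the coinductive relation with rules: if $x\downarrow b$ and $y\downarrow b$ then $x\sqsubseteq y$; if $x\sqsubseteq y$ then $\mathsf{step}\,x\sqsubseteq\mathsf{step}\,y$; if $x\sqsubseteq y$ then $\mathsf{step}\,x\sqsubseteq y$. The function $\mathsf{fstconv}:B^\nu\to B^\nu\to B^\nu$ is defined corecursively by $\mathsf{fstconv}\,(\mathsf{return}\,b)\,y=\mathsf{return}\,b$; $\mathsf{fstconv}\,(\mathsf{step}\,x)\,(\mathsf{return}\,b)=\mathsf{return}\,b$; $\mathsf{fstconv}\,(\mathsf{step}\,x)\,(\mathsf{step}\,y)=\mathsf{step}(\mathsf{fstconv}\,x\,y)$. -}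

module Defs where

open import Data.Nat using (ℕ; zero; suc)
open import Data.Maybe using (Maybe; just; nothing)
open import Data.Product using (Σ; _×_)
open import Function using (_∘_)
open import Relation.Binary.PropositionalEquality using (_≡_)

-- We use the standard encoding of the coinductive
-- type B^ν (constructors return : B → B^ν, step : B^ν → B^ν) as the final
-- coalgebra of X ↦ B ⊎ X realised by sequences:
--   x : ℕ → Maybe B ;  x 0 = just b   means  x = return b,
--                      x 0 = nothing  means  x = step (x ∘ suc).
Delay : Set → Set
Delay B = ℕ → Maybe B

return : {B : Set} → B → Delay B
return b _ = just b

step : {B : Set} → Delay B → Delay B
step x zero    = nothing
step x (suc n) = x n

later : {B : Set} → Delay B → Delay B
later x = x ∘ suc

infix 4 _↓_ _⊑_

data _↓_ {B : Set} (x : Delay B) (b : B) : Set where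
  conv-return : x 0 ≡ just b → x ↓ b
  conv-step   : x 0 ≡ nothing → later x ↓ b → x ↓ b

-- One layer of the rules of the convergence order, with premises in R:
--   x ↓ b, y ↓ b ⇒ x ⊑ y ;  R x y ⇒ step x ⊑ step y ;  R x y ⇒ step x ⊑ y
data ⊑-Rule {B : Set} (R : Delay B → Delay B → Set) (x y : Delay B) : Set where
  ⊑-conv     : (b : B) → x ↓ b → y ↓ b → ⊑-Rule R x y
  ⊑-stepstep : x 0 ≡ nothing → y 0 ≡ nothing → R (later x) (later y) → ⊑-Rule R x y
  ⊑-stepleft : x 0 ≡ nothing → R (later x) y → ⊑-Rule R x y

-- The coinductive relation x ⊑ y: greatest fixed point of ⊑-Rule, i.e.
-- x and y are related by some post-fixed point (a ⊑-Rule-consistent relation).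
_⊑_ : {B : Set} → Delay B → Delay B → Set₁
_⊑_ {B} x y = Σ (Delay B → Delay B → Set) λ R →
                R x y × (∀ u v → R u v → ⊑-Rule R u v)

-- fstconv (corecursive):
--   fstconv (return b) y          = return b
--   fstconv (step x) (return b)   = return b
--   fstconv (step x) (step y)     = step (fstconv x y)
fstconv : {B : Set} → Delay B → Delay B → Delay B
fstconv x y n with x 0 | y 0
... | just b  | _       = just b
... | nothing | just b  = just b
fstconv x y zero    | nothing | nothing = nothing
fstconv x y (suc n) | nothing | nothing = fstconv (later x) (later y) n

-- If x ⊑ y and x ↓ b, then y ↓ b as well: following the rules of ⊑ along the
-- finitely many steps of x ↓ b, the only rule applicable once x has returned is
-- the convergence rule, and convergence values are unique.  Since x and y both
-- converge to b, so does fstconv x y, by induction on the two convergence proofs.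
module Submission where

open import Defs
open import Data.Nat using (suc)
open import Data.Maybe using (just; nothing)
open import Data.Maybe.Properties using (just-injective)
open import Data.Product using (_,_)
open import Relation.Binary.PropositionalEquality

private
  variable
    B : Set

↓-later : {x : Delay B} {b : B} → x 0 ≡ nothing → x ↓ b → later x ↓ b
↓-later x0 (conv-return p) with () ← trans (sym x0) p
↓-later x0 (conv-step _ h) = h

↓-functional : {x : Delay B} {b c : B} → x ↓ b → x ↓ c → b ≡ c
↓-functional (conv-return p) (conv-return q) = just-injective (trans (sym p) q)
↓-functional (conv-return p) (conv-step q _) with () ← trans (sym q) p
↓-functional (conv-step p h) k = ↓-functional h (↓-later p k)

↓-resp-≗ : {x y : Delay B} {b : B} → (∀ n → x n ≡ y n) → x ↓ b → y ↓ b
↓-resp-≗ x≗y (conv-return p) = conv-return (trans (sym (x≗y 0)) p)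
↓-resp-≗ x≗y (conv-step p h) =
  conv-step (trans (sym (x≗y 0)) p) (↓-resp-≗ (λ n → x≗y (suc n)) h)

fstconv-return : (x y : Delay B) {b : B} → x 0 ≡ just b → fstconv x y 0 ≡ just b
fstconv-return x y x0 with x 0 | y 0
fstconv-return x y refl | just b | _ = refl

fstconv-step-return : (x y : Delay B) {b : B} →
                      x 0 ≡ nothing → y 0 ≡ just b → fstconv x y 0 ≡ just b
fstconv-step-return x y x0 y0 with x 0 | y 0
fstconv-step-return x y refl refl | nothing | just b = refl

fstconv-step-step-head : (x y : Delay B) →
                         x 0 ≡ nothing → y 0 ≡ nothing → fstconv x y 0 ≡ nothing
fstconv-step-step-head x y x0 y0 with x 0 | y 0
fstconv-step-step-head x y refl refl | nothing | nothing = refl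

fstconv-step-step-later : (x y : Delay B) → x 0 ≡ nothing → y 0 ≡ nothing →
                          ∀ n → fstconv (later x) (later y) n ≡ later (fstconv x y) n
fstconv-step-step-later x y x0 y0 n with x 0 | y 0
fstconv-step-step-later x y refl refl n | nothing | nothing = refl

fstconv-↓ : (x y : Delay B) {b : B} → x ↓ b → y ↓ b → fstconv x y ↓ b
fstconv-↓ x y (conv-return p) _ = conv-return (fstconv-return x y p)
fstconv-↓ x y (conv-step p _) (conv-return q) = conv-return (fstconv-step-return x y p q)
fstconv-↓ x y (conv-step p h) (conv-step q k) =
  conv-step (fstconv-step-step-head x y p q)
            (↓-resp-≗ (fstconv-step-step-later x y p q) (fstconv-↓ (later x) (later y) h k))

module _ (R : Delay B → Delay B → Set) (post : ∀ u v → R u v → ⊑-Rule R u v) where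

  post-fixed-↓ : (x y : Delay B) {b : B} → R x y → x ↓ b → y ↓ b
  post-fixed-↓ x y xRy x↓ with post x y xRy | x↓
  ... | ⊑-conv _ x↓c y↓c     | _               = subst (y ↓_) (↓-functional x↓c x↓) y↓c
  ... | ⊑-stepstep x0 _ _    | conv-return p   with () ← trans (sym x0) p
  ... | ⊑-stepstep _ y0 xRy′ | conv-step _ x′↓ = conv-step y0 (post-fixed-↓ (later x) (later y) xRy′ x′↓)
  ... | ⊑-stepleft x0 _      | conv-return p   with () ← trans (sym x0) p
  ... | ⊑-stepleft _ xRy′    | conv-step _ x′↓ = post-fixed-↓ (later x) y xRy′ x′↓

⊑-↓ : {x y : Delay B} {b : B} → x ⊑ y → x ↓ b → y ↓ b
⊑-↓ {x = x} {y} (R , xRy , post) = post-fixed-↓ R post x y xRy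

lemma6p11 : {B : Set} (x y : Delay B) (b : B) → x ⊑ y → x ↓ b → fstconv x y ↓ b
lemma6p11 x y b x⊑y x↓ = fstconv-↓ x y x↓ (⊑-↓ x⊑y x↓)
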